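{- Let $G=(V,A,s)$ be an acyclic flow graph. Consider the modification of Algorithm AD (Version 1) in which each contraction of a vertex $v$ into its current parent is preceded by deleting all arcs into $v$. Then for every choice of spanning tree, bottom-up numbering, and order in which arcs are selected, the modified algorithm terminates and, for every vertex $w\neq s$, assigns to $d(w)$ the immediate dominator of $w$ in $G$.
   Context: A flow graph $G=(V,A,s)$ is a finite directed graph with start vertex $s$ from which every vertex is reachable; assume $n=|V|>1$, no arcs enter $s$, and $G$ has no multiple arcs and no loop arcs. $G$ is acyclic if it has no cycle of more than one vertex. A vertex $x$ dominates $y$ if every path from $s$ to $y$ contains $x$; the immediate dominator of $y\neq s$ is the unique dominator $d(y)\ne y$ of $y$ dominated by all dominators of $y$ other than $y$. For a spanning tree with parent function $p$, an arc $(x,w)$ is a tree arc if $x=p(w)$ and a forward arc if $x$ is a proper ancestor of $p(w)$. Contracting $v$ into $p(v)$ replaces every arc end equal to $v$ by $p(v)$, deletes $v$, and makes the former children of $v$ children of $p(v)$ in the current spanning tree; arcs produced by a contraction inherit the mark of the arc they replace. Algorithm AD (Version 1): choose any spanning tree $T$ of $G$ rooted at $s$ with parent function $p$; number the vertices $1,\dots,n$ with $x<p(x)$ for all $x\ne s$ and identify vertices with numbers; unmark all arcs; set $\mathit{same}(x)=\{x\}$ for all $x$. For $u=1,\dots,n$: while some tree or forward arc $(u,v)$ (with respect to the current tree and graph) is unmarked: mark $(u,v)$; if all arcs into $v$ are marked, then (if $u=p(v)$ set $d(w)\leftarrow u$ for all $w\in\mathit{same}(v)$, else $\mathit{same}(p(v))\leftarrow\mathit{same}(p(v))\cup\mathit{same}(v)$)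 and contract $v$ into its current parent $p(v)$. -}

module Defs where

open import Data.Nat using (ℕ; zero; suc; _<_)
open import Data.Fin using (Fin; toℕ) renaming (_<_ to _<ᶠ_)
open import Data.Fin.Properties using (_≟_)
open import Data.Bool using (Bool; true; false; if_then_else_; not; _∨_)
open import Data.Maybe using (Maybe; just; nothing)
open import Data.List using (List; []; _∷_; map; filterᵇ; length; lookup; updateAt)
open import Data.List.Membership.Propositional using (_∈_)
open import Data.List.Relation.Unary.All using (All)
open import Data.List.Relation.Unary.Unique.Propositional using (Unique)
open import Data.Product using (Σ; _×_; _,_)
open import Data.Sum using (_⊎_)
open import Relation.Nullary using (¬_; ⌊_⌋)
open import Relation.Binary.PropositionalEquality using (_≡_; _≢_)
open import Relation.Binary.Construct.Closure.ReflexiveTransitive using (Star)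
open import Induction.WellFounded using (Acc)

-- Graphs on vertex set Fin n; the arc set is a list of pairs
-- (vertices are identified with their numbers 0..n-1, i.e. 1..n shifted)

Arcs : ℕ → Set
Arcs n = List (Fin n × Fin n)

module _ {n : ℕ} (A : Arcs n) where

  data Walk : Fin n → Fin n → List (Fin n) → Set where
    here : ∀ {x} → Walk x x (x ∷ [])
    step : ∀ {x y z vs} → (x , y) ∈ A → Walk y z vs → Walk x z (x ∷ vs)

  Reach : Fin n → Fin n → Set
  Reach x y = Σ (List (Fin n)) λ vs → Walk x y vs

  NoLoops : Set
  NoLoops = ∀ x → ¬ ((x , x) ∈ A)

  Acyclic : Set
  Acyclic = ∀ x y → (x , y) ∈ A → x ≢ y → ¬ Reach y x

  IsFlowGraph : Fin n → Set
  IsFlowGraph s =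
    (1 < n) × Unique A × NoLoops × (∀ x → ¬ ((x , s) ∈ A)) × (∀ y → Reach s y)

  Dominates : Fin n → Fin n → Fin n → Set
  Dominates s x y = ∀ vs → Walk s y vs → x ∈ vs

  IsIdom : Fin n → Fin n → Fin n → Set
  IsIdom s x y =
    Dominates s x y × x ≢ y × (∀ z → Dominates s z y → z ≢ y → Dominates s z x)

-- Rooted trees given by a parent function (the value at the root s is
-- irrelevant)

module _ {n : ℕ} (s : Fin n) (par : Fin n → Fin n) where

  data Anc : Fin n → Fin n → Set where
    here : ∀ {x} → Anc x x
    up   : ∀ {x y} → y ≢ s → Anc x (par y) → Anc x y

  ProperAnc : Fin n → Fin n → Set
  ProperAnc x y = Anc x y × x ≢ y

  TreeArc : Fin n → Fin n → Set
  TreeArc x w = w ≢ s × x ≡ par w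

  ForwardArc : Fin n → Fin n → Set
  ForwardArc x w = w ≢ s × ProperAnc x (par w)

IsSpanningTree : ∀ {n} → Arcs n → Fin n → (Fin n → Fin n) → Set
IsSpanningTree A s p = (∀ x → x ≢ s → (p x , x) ∈ A) × (∀ x → Anc s p s x)

BottomUp : ∀ {n} → Fin n → (Fin n → Fin n) → Set
BottomUp s p = ∀ x → x ≢ s → x <ᶠ p x

-- Algorithm AD (Version 1), modified: before contracting v, delete all
-- arcs into v.  Nondeterministic small-step semantics.

-- an arc of the current graph with its mark
MArc : ℕ → Set
MArc n = Fin n × Fin n × Bool

record State (n : ℕ) : Set where
  constructor st
  field
    cur  : ℕ                    -- current value of u (0-based); loop ends when cur = n
    arcs : List (MArc n)        -- current (multi)graph with marks
    par  : Fin n → Fin n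
    same : Fin n → Fin n → Bool -- same(x) as characteristic function
    dom  : Fin n → Maybe (Fin n) -- d(w); nothing = not yet assigned
open State public

initState : ∀ {n} → Arcs n → (Fin n → Fin n) → State n
initState A p = st 0 (map (λ { (a , b) → (a , b , false) }) A) p
                   (λ x y → ⌊ x ≟ y ⌋) (λ _ → nothing)

target : ∀ {n} → MArc n → Fin n
target (_ , b , _) = b

mark : ∀ {n} → MArc n → MArc n
mark (a , b , _) = (a , b , true)

AllIntoMarked : ∀ {n} → List (MArc n) → Fin n → Set
AllIntoMarked as v = All (λ { (a , b , m) → b ≡ v → m ≡ true }) as

repl : ∀ {n} → Fin n → Fin n → Fin n → Fin n
repl v q x = if ⌊ x ≟ v ⌋ then q else x

contractArcs : ∀ {n} → Fin n → Fin n → List (MArc n) → List (MArc n)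
contractArcs v q as =
  map (λ { (a , b , m) → (repl v q a , repl v q b , m) })
      (filterᵇ (λ { (a , b , m) → not ⌊ b ≟ v ⌋ }) as)

contractPar : ∀ {n} → Fin n → Fin n → (Fin n → Fin n) → Fin n → Fin n
contractPar v q par w = if ⌊ par w ≟ v ⌋ then q else par w

Selectable : ∀ {n} → Fin n → (σ : State n) → Fin (length (arcs σ)) → Fin n → Fin n → Set
Selectable s σ i u' v =
  lookup (arcs σ) i ≡ (u' , v , false) × toℕ u' ≡ cur σ ×
  (TreeArc s (par σ) u' v ⊎ ForwardArc s (par σ) u' v)

data Step {n : ℕ} (s : Fin n) : State n → State n → Set where
  markOnly : ∀ {c as pr sm d} (i : Fin (length as)) {u' v} →
    Selectable s (st c as pr sm d) i u' v →
    ¬ AllIntoMarked (updateAt as i mark) v →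
    Step s (st c as pr sm d) (st c (updateAt as i mark) pr sm d)
  markTree : ∀ {c as pr sm d} (i : Fin (length as)) {u' v} →
    Selectable s (st c as pr sm d) i u' v →
    AllIntoMarked (updateAt as i mark) v →
    u' ≡ pr v →
    Step s (st c as pr sm d)
           (st c (contractArcs v (pr v) (updateAt as i mark))
                 (contractPar v (pr v) pr) sm
                 (λ w → if sm v w then just u' else d w))
  markFwd : ∀ {c as pr sm d} (i : Fin (length as)) {u' v} →
    Selectable s (st c as pr sm d) i u' v →
    AllIntoMarked (updateAt as i mark) v →
    u' ≢ pr v →
    Step s (st c as pr sm d)
           (st c (contractArcs v (pr v) (updateAt as i mark))
                 (contractPar v (pr v) pr)
                 (λ x w → if ⌊ x ≟ pr v ⌋ then (sm x w ∨ sm v w) else sm x w) d)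
  next : ∀ {σ} → cur σ < n →
    ¬ (Σ (Fin (length (arcs σ))) λ i → Σ (Fin n) λ u' → Σ (Fin n) λ v → Selectable s σ i u' v) →
    Step s σ (record σ { cur = suc (cur σ) })

Finished : ∀ {n} → State n → Set
Finished {n} σ = cur σ ≡ n

CorrectIdoms : ∀ {n} → Arcs n → Fin n → State n → Set
CorrectIdoms {n} A s σ =
  ∀ w → w ≢ s → Σ (Fin n) λ x → dom σ w ≡ just x × IsIdom A s x w

-- Alongside the algorithm we track, for each original vertex y, the vertex rep y into which
-- it has been contracted.  The invariant says in essence: an unprocessed representative
-- dominates its whole class; every vertex properly dominated by an already processed vertex
-- has been contracted; arcs of the current graph are images of original arcs, and a marked
-- arc into b comes from a tree ancestor of p(b) numbered at most u.
-- When the last arc (u, v) into v gets marked, every path to v therefore enters v from a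
-- class whose representative lies on the tree path from u to p(v).  If u = p(v) this makes u
-- the immediate dominator of v; otherwise v and p(v) have the same proper dominators, which
-- justifies merging same(v) into same(p(v)).  When no selectable arc leaves u, an alive
-- vertex properly dominated by u would have an unmarked incoming arc from another such
-- vertex, and iterating gives an infinite backward chain, impossible in an acyclic graph.
-- Termination is lexicographic in (n − u, number of unmarked arcs).

module Submission where

open import Defs
open import Data.Nat using (ℕ; zero; suc; _≤_; _<_; z≤n; s≤s; _∸_)
import Data.Nat.Properties as ℕ
open import Data.Nat.Induction using (<-wellFounded)
open import Data.Fin as Fin using (Fin; toℕ; fromℕ<) renaming (_<_ to _<ᶠ_)
open import Data.Fin.Properties using (_≟_; toℕ-injective; toℕ<n; toℕ-fromℕ<; pigeonhole; any?)
open import Data.Bool using (Bool; true; false; not; T; if_then_else_; _∨_)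
open import Data.Bool.Properties using (∨-zeroʳ) renaming (_≟_ to _≟ᵇ_)
open import Data.Maybe using (Maybe; just)
open import Data.Maybe.Properties using (just-injective)
open import Data.Empty using (⊥-elim)
open import Data.Product using (Σ; _×_; _,_; proj₁; proj₂)
open import Data.Product.Relation.Binary.Lex.Strict using (×-Lex; ×-wellFounded)
open import Data.Sum using (_⊎_; inj₁; inj₂; map₁; [_,_]′)
open import Data.List using (List; []; _∷_; length; lookup; updateAt)
open import Data.List.Membership.Propositional using (_∈_)
open import Data.List.Membership.Propositional.Properties using (∈-lookup; ∈-map⁺; ∈-map⁻; ∈-filter⁺; ∈-filter⁻)
open import Data.List.Relation.Binary.Subset.Propositional using (_⊆_)
open import Data.List.Relation.Unary.All using ([]; _∷_)
open import Data.List.Relation.Unary.Any using (here; there; index)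
open import Data.List.Relation.Unary.Any.Properties using (lookup-index)
open import Function using (id; _∘_)
open import Induction.WellFounded using (Acc; WellFounded; module Subrelation)
open import Relation.Nullary using (¬_; Dec; yes; no; ⌊_⌋)
open import Relation.Nullary.Decidable using (toSum)
open import Relation.Binary.Construct.Closure.ReflexiveTransitive using (Star; ε; _◅_)
import Relation.Binary.Construct.On as On
open import Relation.Binary.PropositionalEquality using (_≡_; _≢_; refl; sym; trans; cong; subst; subst₂)

module Walks {n : ℕ} (A : Arcs n) where

  walk-head∈ : ∀ {x z vs} → Walk A x z vs → x ∈ vs
  walk-head∈ here       = here refl
  walk-head∈ (step _ _) = here refl

  walk-last∈ : ∀ {x z vs} → Walk A x z vs → z ∈ vs
  walk-last∈ here       = here refl
  walk-last∈ (step _ w) = there (walk-last∈ w)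

  walk-++ : ∀ {x y z vs ws} → Walk A x y vs → Walk A y z ws →
    Σ (List (Fin n)) λ us → Walk A x z us × (∀ {t} → t ∈ us → t ∈ vs ⊎ t ∈ ws)
  walk-++ here w = _ , w , inj₂
  walk-++ (step a w₁) w₂ with walk-++ w₁ w₂
  ... | us , w , split = _ , step a w , λ { (here e) → inj₁ (here e) ; (there t) → map₁ there (split t) }

  walk-snoc : ∀ {x y z vs} → Walk A x y vs → (y , z) ∈ A →
    Σ (List (Fin n)) λ us → Walk A x z us × (∀ {t} → t ∈ us → t ∈ vs ⊎ t ≡ z)
  walk-snoc {y = y} {z} {vs} w a with walk-++ w (step a here)
  ... | us , w′ , split = us , w′ , λ t → last (split t)
    where
    last : ∀ {t} → t ∈ vs ⊎ t ∈ (y ∷ z ∷ []) → t ∈ vs ⊎ t ≡ z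
    last (inj₁ t)                   = inj₁ t
    last (inj₂ (here refl))         = inj₁ (walk-last∈ w)
    last (inj₂ (there (here e)))    = inj₂ e
    last (inj₂ (there (there ())))

  walk-prefix : ∀ {x z vs y} → Walk A x z vs → y ∈ vs →
    Σ (List (Fin n)) λ us → Walk A x y us × us ⊆ vs
  walk-prefix here       (here refl) = _ , here , id
  walk-prefix (step _ _) (here refl) = _ , here , λ { (here e) → here e ; (there ()) }
  walk-prefix (step a w) (there t) with walk-prefix w t
  ... | us , w′ , sub = _ , step a w′ , λ { (here e) → here e ; (there t) → there (sub t) }

  walk-lastArc : ∀ {x v vs} → Walk A x v vs → x ≢ v →
    Σ (Fin n) λ a → (a , v) ∈ A × Σ (List (Fin n)) λ us → Walk A x a us × us ⊆ vs
  walk-lastArc here x≢v = ⊥-elim (x≢v refl)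
  walk-lastArc {x} (step {y = y} {z = v} a w) x≢v with y ≟ v
  ... | yes refl = x , a , _ , here , λ { (here e) → here e ; (there ()) }
  ... | no y≢v with walk-lastArc w y≢v
  ...   | b , ba , us , w′ , sub = b , ba , _ , step a w′ , λ { (here e) → here e ; (there t) → there (sub t) }

  module _ (s : Fin n) where

    dominates-refl : ∀ y → Dominates A s y y
    dominates-refl y vs w = walk-last∈ w

    dominates-trans : ∀ {x y z} → Dominates A s x y → Dominates A s y z → Dominates A s x z
    dominates-trans dxy dyz vs w with walk-prefix w (dyz vs w)
    ... | us , w′ , sub = sub (dxy us w′)

  Reach⁺ : Fin n → Fin n → Set
  Reach⁺ x z = Σ (Fin n) λ y → (x , y) ∈ A × Reach A y z

  reach-trans : ∀ {x y z} → Reach A x y → Reach A y z → Reach A x z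
  reach-trans (_ , w₁) (_ , w₂) with walk-++ w₁ w₂
  ... | us , w , _ = us , w

  reach⁺-trans : ∀ {x y z} → Reach⁺ x y → Reach⁺ y z → Reach⁺ x z
  reach⁺-trans (y₁ , a , r) (_ , b , r′) = y₁ , a , reach-trans r (reach-trans (_ , step b here) r′)

  walk-arc⇒reach⁺ : ∀ {x y z vs} → Walk A x y vs → (y , z) ∈ A → Reach⁺ x z
  walk-arc⇒reach⁺ {z = z} here b = z , b , _ , here
  walk-arc⇒reach⁺ (step {y = y} a w) b with walk-snoc w b
  ... | us , w′ , _ = y , a , us , w′

  -- A predicate whose every instance is reached, by a nonempty path, from another instance
  -- would yield an infinite backward chain; by pigeonhole two of its first n+1 members
  -- coincide, closing a cycle.
  module _ (noLoops : NoLoops A) (acyclic : Acyclic A) where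

    ¬reach⁺-self : ∀ x → ¬ Reach⁺ x x
    ¬reach⁺-self x (y , a , r) with x ≟ y
    ... | yes refl = noLoops x a
    ... | no x≢y   = acyclic x y a x≢y r

    no-infinite-descent : (P : Fin n → Set) →
      (∀ w → P w → Σ (Fin n) λ x → P x × Reach⁺ x w) → ∀ w → ¬ P w
    no-infinite-descent P pred w pw =
      let i , j , i<j , eq = pigeonhole (ℕ.n<1+n n) (λ (i : Fin (suc n)) → proj₁ (chain (toℕ i)))
      in  ¬reach⁺-self _ (subst (λ t → Reach⁺ t (proj₁ (chain (toℕ i)))) (sym eq)
                               (chain-reach (toℕ i) (toℕ j) i<j))
      where
      chain : ℕ → Σ (Fin n) P
      chain zero    = w , pw
      chain (suc k) = let x , px , _ = pred (proj₁ (chain k)) (proj₂ (chain k)) in x , px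

      chain-step : ∀ k → Reach⁺ (proj₁ (chain (suc k))) (proj₁ (chain k))
      chain-step k = proj₂ (proj₂ (pred (proj₁ (chain k)) (proj₂ (chain k))))

      chain-reach : ∀ k m → k < m → Reach⁺ (proj₁ (chain m)) (proj₁ (chain k))
      chain-reach k (suc m) (s≤s k≤m) with ℕ.m≤n⇒m<n∨m≡n k≤m
      ... | inj₂ refl = chain-step k
      ... | inj₁ k<m  = reach⁺-trans (chain-step m) (chain-reach k m k<m)

module BottomUpTree {n : ℕ} (s : Fin n) (π : Fin n → Fin n) (bottomUp : BottomUp s π) where

  anc-step⁻ : ∀ {x y} → Anc s π x y → x ≢ y → y ≢ s × Anc s π x (π y)
  anc-step⁻ here       x≢y = ⊥-elim (x≢y refl)
  anc-step⁻ (up y≢s a) _   = y≢s , a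

  anc-trans : ∀ {x y z} → Anc s π x y → Anc s π y z → Anc s π x z
  anc-trans a here       = a
  anc-trans a (up z≢s b) = up z≢s (anc-trans a b)

  anc⇒≥ : ∀ {x y} → Anc s π x y → toℕ y ≤ toℕ x
  anc⇒≥ here               = ℕ.≤-refl
  anc⇒≥ {y = y} (up y≢s a) = ℕ.≤-trans (ℕ.<⇒≤ (bottomUp y y≢s)) (anc⇒≥ a)

  anc⇒> : ∀ {x y} → Anc s π x y → x ≢ y → toℕ y < toℕ x
  anc⇒> here               x≢y = ⊥-elim (x≢y refl)
  anc⇒> {y = y} (up y≢s a) _   = ℕ.<-≤-trans (bottomUp y y≢s) (anc⇒≥ a)

  anc-antisym : ∀ {x y} → Anc s π x y → Anc s π y x → x ≡ y
  anc-antisym a b = toℕ-injective (ℕ.≤-antisym (anc⇒≥ b) (anc⇒≥ a))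

  anc-linear : ∀ {x y z} → Anc s π x z → Anc s π y z → Anc s π x y ⊎ Anc s π y x
  anc-linear here     b        = inj₂ b
  anc-linear (up z≢s a) here   = inj₁ (up z≢s a)
  anc-linear (up _ a) (up _ b) = anc-linear a b

  anc-root : ∀ {x} → Anc s π x s → x ≡ s
  anc-root here       = refl
  anc-root (up s≢s _) = ⊥-elim (s≢s refl)

  anc? : ∀ x y → Dec (Anc s π x y)
  anc? x y = bounded n y (ℕ.m∸n≤m n (toℕ y))
    where
    -- recursion on n ∸ y, which decreases when passing to the parent
    bounded : ∀ k y → n ∸ toℕ y ≤ k → Dec (Anc s π x y)
    bounded zero y h = ⊥-elim (ℕ.<⇒≱ (toℕ<n y) (ℕ.m∸n≡0⇒m≤n (ℕ.n≤0⇒n≡0 h)))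
    bounded (suc k) y h with x ≟ y
    ... | yes refl = yes here
    ... | no x≢y with y ≟ s
    ...   | yes refl = no λ a → x≢y (anc-root a)
    ...   | no y≢s with bounded k (π y)
                      (ℕ.≤-pred (ℕ.≤-trans (ℕ.∸-monoʳ-< (bottomUp y y≢s) (ℕ.<⇒≤ (toℕ<n (π y)))) h))
    ...     | yes a = yes (up y≢s a)
    ...     | no ¬a = no λ a → ¬a (proj₂ (anc-step⁻ a x≢y))

module Contraction {n : ℕ} (s : Fin n) (π : Fin n → Fin n) (bottomUp : BottomUp s π)
                   (v : Fin n) (v≢s : v ≢ s) where

  q : Fin n
  q = π v

  f : Fin n → Fin n
  f = repl v q

  π′ : Fin n → Fin n
  π′ = contractPar v q π

  q≢v : q ≢ v
  q≢v e = ℕ.<-irrefl (cong toℕ (sym e)) (bottomUp v v≢s)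

  f-v : f v ≡ q
  f-v with v ≟ v
  ... | yes _  = refl
  ... | no v≢v = ⊥-elim (v≢v refl)

  f-id : ∀ {x} → x ≢ v → f x ≡ x
  f-id {x} x≢v with x ≟ v
  ... | yes x≡v = ⊥-elim (x≢v x≡v)
  ... | no _    = refl

  π′-child : ∀ {b} → π b ≡ v → π′ b ≡ q
  π′-child {b} e with π b ≟ v
  ... | yes _ = refl
  ... | no ne = ⊥-elim (ne e)

  π′-other : ∀ {b} → π b ≢ v → π′ b ≡ π b
  π′-other {b} ne with π b ≟ v
  ... | yes e = ⊥-elim (ne e)
  ... | no _  = refl

  anc-contract : ∀ {a b} → Anc s π a b → Anc s π′ (f a) (f b)
  anc-contract here = here
  anc-contract {a} {b} (up b≢s anc) = by-cases (b ≟ v)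
    where
    by-cases : Dec (b ≡ v) → Anc s π′ (f a) (f b)
    by-cases (yes b≡v) = subst (Anc s π′ (f a))
      (trans (cong (f ∘ π) b≡v) (trans (f-id q≢v) (trans (sym f-v) (cong f (sym b≡v))))) (anc-contract anc)
    by-cases (no b≢v) = subst (Anc s π′ (f a)) (sym (f-id b≢v)) (up b≢s (anc-contract anc))

  -- Al is any parent-closed set containing q, in practice the alive vertices.
  anc-uncontract : (Al : Fin n → Set) → (∀ y → Al y → y ≢ s → Al (π y)) → Al q →
    ∀ {a b} → Anc s π′ a b → Al b → b ≢ v → Anc s π a b
  anc-uncontract Al closed al-q here _ _ = here
  anc-uncontract Al closed al-q {a} {b} (up b≢s anc) al-b b≢v with π b ≟ v
  ... | yes e = up b≢s (subst (Anc s π a) (sym e) (up v≢s (anc-uncontract Al closed al-q anc al-q q≢v)))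
  ... | no ne = up b≢s (anc-uncontract Al closed al-q anc (closed b al-b b≢s) ne)

∨-true⁻ : ∀ a b → a ∨ b ≡ true → a ≡ true ⊎ b ≡ true
∨-true⁻ true  _ _ = inj₁ refl
∨-true⁻ false _ e = inj₂ e

module _ {a} {X : Set a} where

  ∈-updateAt⁺ : ∀ (xs : List X) i g {x} → x ∈ xs →
    x ∈ updateAt xs i g ⊎ (x ≡ lookup xs i × g x ∈ updateAt xs i g)
  ∈-updateAt⁺ (y ∷ xs) Fin.zero    g (here refl) = inj₂ (refl , here refl)
  ∈-updateAt⁺ (y ∷ xs) Fin.zero    g (there x∈)  = inj₁ (there x∈)
  ∈-updateAt⁺ (y ∷ xs) (Fin.suc i) g (here refl) = inj₁ (here refl)
  ∈-updateAt⁺ (y ∷ xs) (Fin.suc i) g (there x∈) with ∈-updateAt⁺ xs i g x∈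
  ... | inj₁ x∈′       = inj₁ (there x∈′)
  ... | inj₂ (e , x∈′) = inj₂ (e , there x∈′)

  ∈-updateAt⁻ : ∀ (xs : List X) i g {x} → x ∈ updateAt xs i g → x ∈ xs ⊎ x ≡ g (lookup xs i)
  ∈-updateAt⁻ (y ∷ xs) Fin.zero    g (here e)   = inj₂ e
  ∈-updateAt⁻ (y ∷ xs) Fin.zero    g (there x∈) = inj₁ (there x∈)
  ∈-updateAt⁻ (y ∷ xs) (Fin.suc i) g (here e)   = inj₁ (here e)
  ∈-updateAt⁻ (y ∷ xs) (Fin.suc i) g (there x∈) = map₁ there (∈-updateAt⁻ xs i g x∈)

  updated∈updateAt : ∀ (xs : List X) i g → g (lookup xs i) ∈ updateAt xs i g
  updated∈updateAt (y ∷ xs) Fin.zero    g = here refl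
  updated∈updateAt (y ∷ xs) (Fin.suc i) g = there (updated∈updateAt xs i g)

module _ {n : ℕ} where

  private
    skip : ∀ {e : MArc n} {L v} → Σ (Fin n) (λ x → (x , v , false) ∈ L) → Σ (Fin n) λ x → (x , v , false) ∈ e ∷ L
    skip (x , x∈) = x , there x∈

  unmarked-into : ∀ (L : List (MArc n)) v → ¬ AllIntoMarked L v → Σ (Fin n) λ x → (x , v , false) ∈ L
  unmarked-into [] v ¬all = ⊥-elim (¬all [])
  unmarked-into ((a , b , m) ∷ L) v ¬all with b ≟ v | m
  ... | yes refl | false = a , here refl
  ... | yes _    | true  = skip (unmarked-into L v (λ all → ¬all ((λ _ → refl) ∷ all)))
  ... | no b≢v   | _     = skip (unmarked-into L v (λ all → ¬all ((⊥-elim ∘ b≢v) ∷ all)))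

  allIntoMarked⇒marked : ∀ {L : List (MArc n)} {v x m} → AllIntoMarked L v → (x , v , m) ∈ L → m ≡ true
  allIntoMarked⇒marked (px ∷ _)   (here refl) = px refl
  allIntoMarked⇒marked (_  ∷ all) (there e∈)  = allIntoMarked⇒marked all e∈

  allIntoMarked? : ∀ (L : List (MArc n)) v → Dec (AllIntoMarked L v)
  allIntoMarked? [] v = yes []
  allIntoMarked? ((a , b , m) ∷ L) v with allIntoMarked? L v
  ... | no ¬all = no λ { (_ ∷ all) → ¬all all }
  ... | yes all with b ≟ v | m ≟ᵇ true
  ...   | no b≢v  | _         = yes ((λ b≡v → ⊥-elim (b≢v b≡v)) ∷ all)
  ...   | yes _   | yes m≡t   = yes ((λ _ → m≡t) ∷ all)
  ...   | yes b≡v | no m≢t    = no λ { (px ∷ _) → m≢t (px b≡v) }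

  module _ (v q : Fin n) where

    private
      kept⁺ : ∀ b → b ≢ v → T (not ⌊ b ≟ v ⌋)
      kept⁺ b b≢v with b ≟ v
      ... | yes b≡v = b≢v b≡v
      ... | no _    = _

      kept⁻ : ∀ b → T (not ⌊ b ≟ v ⌋) → b ≢ v
      kept⁻ b t b≡v with b ≟ v
      ... | yes _   = t
      ... | no b≢v  = b≢v b≡v

    ∈-contractArcs⁺ : ∀ {L : List (MArc n)} {x b m} → (x , b , m) ∈ L → b ≢ v →
      (repl v q x , repl v q b , m) ∈ contractArcs v q L
    ∈-contractArcs⁺ e∈ b≢v = ∈-map⁺ _ (∈-filter⁺ _ e∈ (kept⁺ _ b≢v))

    ∈-contractArcs⁻ : ∀ {L : List (MArc n)} {e} → e ∈ contractArcs v q L →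
      Σ (Fin n) λ x → Σ (Fin n) λ b → Σ Bool λ m →
        (x , b , m) ∈ L × b ≢ v × e ≡ (repl v q x , repl v q b , m)
    ∈-contractArcs⁻ e∈ with ∈-map⁻ _ e∈
    ... | (x , b , m) , e∈′ , refl with ∈-filter⁻ _ e∈′
    ...   | e∈L , t = x , b , m , e∈L , kept⁻ b t , refl

#unmarked : ∀ {n} → List (MArc n) → ℕ
#unmarked []                    = 0
#unmarked ((_ , _ , false) ∷ L) = suc (#unmarked L)
#unmarked ((_ , _ , true)  ∷ L) = #unmarked L

#unmarked-mark : ∀ {n} (L : List (MArc n)) i {x y} → lookup L i ≡ (x , y , false) →
  #unmarked (updateAt L i mark) < #unmarked L
#unmarked-mark ((_ , _ , _)     ∷ L) Fin.zero    refl = ℕ.≤-refl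
#unmarked-mark ((_ , _ , false) ∷ L) (Fin.suc i) e    = s≤s (#unmarked-mark L i e)
#unmarked-mark ((_ , _ , true)  ∷ L) (Fin.suc i) e    = #unmarked-mark L i e

#unmarked-contract : ∀ {n} (v q : Fin n) (L : List (MArc n)) → #unmarked (contractArcs v q L) ≤ #unmarked L
#unmarked-contract v q [] = z≤n
#unmarked-contract v q ((a , b , m) ∷ L) with b ≟ v | m
... | yes _ | false = ℕ.m≤n⇒m≤1+n (#unmarked-contract v q L)
... | yes _ | true  = #unmarked-contract v q L
... | no _  | false = s≤s (#unmarked-contract v q L)
... | no _  | true  = #unmarked-contract v q L

module _ {n : ℕ} (s : Fin n) where

  measure : State n → ℕ × ℕ
  measure σ = n ∸ cur σ , #unmarked (arcs σ)

  step-decreases : ∀ {σ σ′} → Step s σ σ′ → ×-Lex _≡_ _<_ _<_ (measure σ′) (measure σ)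
  step-decreases (markOnly {as = as} i sel _) = inj₂ (refl , #unmarked-mark as i (proj₁ sel))
  step-decreases (markTree {as = as} {pr = pr} i {v = v} sel _ _) =
    inj₂ (refl , ℕ.≤-<-trans (#unmarked-contract v (pr v) (updateAt as i mark)) (#unmarked-mark as i (proj₁ sel)))
  step-decreases (markFwd {as = as} {pr = pr} i {v = v} sel _ _) =
    inj₂ (refl , ℕ.≤-<-trans (#unmarked-contract v (pr v) (updateAt as i mark)) (#unmarked-mark as i (proj₁ sel)))
  step-decreases (next {σ} c<n _) = inj₁ (ℕ.∸-monoʳ-< (ℕ.n<1+n (cur σ)) c<n)

  step-wellFounded : WellFounded (λ σ′ σ → Step s σ σ′)
  step-wellFounded σ = Subrelation.accessible step-decreases
    (On.accessible measure (×-wellFounded <-wellFounded <-wellFounded (measure σ)))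

module AD {n : ℕ} (A : Arcs n) (s : Fin n) where
  open Walks A

  Dom : Fin n → Fin n → Set
  Dom = Dominates A s

  ProperDom : Fin n → Fin n → Set
  ProperDom y z = Dom z y × z ≢ y

  SameProperDoms : Fin n → Fin n → Set
  SameProperDoms x w = ∀ z → (ProperDom x z → ProperDom w z) × (ProperDom w z → ProperDom x z)

  Alive : (Fin n → Fin n) → Fin n → Set
  Alive rep y = rep y ≡ y

  -- rep y is the current vertex into which the original vertex y has been contracted; it is
  -- not part of the algorithm's state.  c is the current vertex u, π the current tree, sm the
  -- sets same(x), d the assigned dominators and as the current marked arcs.
  record Invariant (c : ℕ) (as : List (MArc n)) (π : Fin n → Fin n)
                   (sm : Fin n → Fin n → Bool) (d : Fin n → Maybe (Fin n))
                   (rep : Fin n → Fin n) : Set where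
    field
      cur≤n              : c ≤ n
      rep-idem           : ∀ y → rep (rep y) ≡ rep y
      rep-s              : rep s ≡ s
      rep-dom            : ∀ y → c ≤ toℕ (rep y) → Dom (rep y) y
      dom-rep⇒dom        : ∀ y z → Alive rep z → z ≢ rep y → Anc s π z (rep y) → Dom z (rep y) → Dom z y
      class-walk         : ∀ y → Σ (List (Fin n)) λ vs → Walk A (rep y) y vs × (∀ {t} → t ∈ vs → rep t ≡ rep y)
      bottomUp           : BottomUp s π
      alive-par          : ∀ x → Alive rep x → x ≢ s → Alive rep (π x)
      par-arc            : ∀ x → Alive rep x → x ≢ s → Σ (Fin n) λ a → (a , x) ∈ A × rep a ≡ π x
      dead<cur           : ∀ x → ¬ Alive rep x → toℕ x < c
      alive-rooted       : ∀ y → Alive rep y → Anc s π s y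
      arc-origin         : ∀ {x b m} → (x , b , m) ∈ as →
                             b ≢ s × Alive rep b × Σ (Fin n) λ a → (a , b) ∈ A × rep a ≡ x
      marked-arc         : ∀ {x b} → (x , b , true) ∈ as → Anc s π x (π b) × toℕ x ≤ c
      arc-present        : ∀ {a b} → (a , b) ∈ A → Alive rep b → Σ Bool λ m → (rep a , b , m) ∈ as
      processed-dom⇒dead : ∀ z w → toℕ z < c → Dom z w → w ≢ z → ¬ Alive rep w
      same-root          : ∀ x w → sm x w ≡ true → x ≡ w ⊎ x ≢ s
      same-refl          : ∀ x → sm x x ≡ true
      same-pdom          : ∀ x w → sm x w ≡ true → SameProperDoms x w
      idom-sound         : ∀ w x → d w ≡ just x → IsIdom A s x w
      idom-pending       : ∀ w → w ≢ s →
                             (Σ (Fin n) λ x → d w ≡ just x) ⊎ (Σ (Fin n) λ x → Alive rep x × sm x w ≡ true)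

  UnmarkedArcInto : List (MArc n) → (Fin n → Fin n) → Set
  UnmarkedArcInto as rep = ∀ b → Alive rep b → b ≢ s → Σ (Fin n) λ x → (x , b , false) ∈ as

  module Consequences {c as π sm d rep} (I : Invariant c as π sm d rep) where
    open Invariant I public
    open BottomUpTree s π bottomUp public

    tree-walk : ∀ {x y} → Anc s π x y → Alive rep y →
      Σ (List (Fin n)) λ vs → Walk A x y vs × (∀ {t} → t ∈ vs → Anc s π x (rep t) × Anc s π (rep t) y)
    tree-walk {y = y} here ay =
      _ , here , λ { (here refl) → subst (Anc s π y) (sym ay) here , subst (λ t → Anc s π t y) (sym ay) here
                   ; (there ()) }
    tree-walk {x} {y} (up y≢s anc) ay with tree-walk anc (alive-par y ay y≢s) | par-arc y ay y≢s
    ... | vs , w , onPath | a , a→y , ra with class-walk a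
    ...   | ws , w₂ , inClass with walk-++ w (subst (λ t → Walk A t a ws) ra w₂)
    ...     | us , w₃ , split with walk-snoc w₃ a→y
    ...       | zs , w₄ , split′ = zs , w₄ , between
      where
      between : ∀ {t} → t ∈ zs → Anc s π x (rep t) × Anc s π (rep t) y
      between t∈ with split′ t∈
      ... | inj₂ refl = subst (Anc s π x) (sym ay) (up y≢s anc) , subst (λ t → Anc s π t y) (sym ay) here
      ... | inj₁ t∈′ with split t∈′
      ...   | inj₁ t∈vs = proj₁ (onPath t∈vs) , anc-trans (proj₂ (onPath t∈vs)) (up y≢s here)
      ...   | inj₂ t∈ws = subst (Anc s π x) (sym (trans (inClass t∈ws) ra)) anc ,
                          subst (λ t → Anc s π t y) (sym (trans (inClass t∈ws) ra)) (up y≢s here)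

    unprocessed-alive : ∀ z → c ≤ toℕ z → Alive rep z
    unprocessed-alive z c≤z with rep z ≟ z
    ... | yes alive = alive
    ... | no dead   = ⊥-elim (ℕ.<⇒≱ (dead<cur z dead) c≤z)

    dominator-alive : ∀ z w → Dom z w → w ≢ z → Alive rep w → Alive rep z
    dominator-alive z w dz w≢z aw with toℕ z ℕ.<? c
    ... | yes z<c = ⊥-elim (processed-dom⇒dead z w z<c dz w≢z aw)
    ... | no z≮c  = unprocessed-alive z (ℕ.≮⇒≥ z≮c)

    -- the tree path from s to w is a path of G up to representatives
    dominator-anc : ∀ z w → Alive rep w → Dom z w → Anc s π (rep z) w
    dominator-anc z w aw dz with tree-walk (alive-rooted w aw) aw
    ... | vs , w′ , between = proj₂ (between (dz vs w′))

  module Initial (noArcIntoS : ∀ x → ¬ (x , s) ∈ A)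
                 (p : Fin n → Fin n) (spanning : IsSpanningTree A s p) (bottomUp₀ : BottomUp s p) where

    σ₀ : State n
    σ₀ = initState A p

    same₀⇒≡ : ∀ x y → same σ₀ x y ≡ true → x ≡ y
    same₀⇒≡ x y e with x ≟ y
    ... | yes x≡y = x≡y
    same₀⇒≡ x y () | no _

    same₀-refl : ∀ x → same σ₀ x x ≡ true
    same₀-refl x with x ≟ x
    ... | yes _  = refl
    ... | no x≢x = ⊥-elim (x≢x refl)

    initial-invariant : Invariant (cur σ₀) (arcs σ₀) p (same σ₀) (dom σ₀) id
    initial-invariant = record
      { cur≤n              = z≤n
      ; rep-idem           = λ _ → refl
      ; rep-s              = refl
      ; rep-dom            = λ y _ → dominates-refl s y
      ; dom-rep⇒dom        = λ _ _ _ _ _ dz → dz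
      ; class-walk         = λ y → _ , here , λ { (here refl) → refl ; (there ()) }
      ; bottomUp           = bottomUp₀
      ; alive-par          = λ _ _ _ → refl
      ; par-arc            = λ x _ x≢s → p x , proj₁ spanning x x≢s , refl
      ; dead<cur           = λ x dead → ⊥-elim (dead refl)
      ; alive-rooted       = λ y _ → proj₂ spanning y
      ; arc-origin         = origin
      ; marked-arc         = unmarked
      ; arc-present        = λ a→b _ → false , ∈-map⁺ _ a→b
      ; processed-dom⇒dead = λ _ _ ()
      ; same-root          = λ x w e → inj₁ (same₀⇒≡ x w e)
      ; same-refl          = same₀-refl
      ; same-pdom          = λ x w e z → subst (λ t → (ProperDom x z → ProperDom t z) × (ProperDom t z → ProperDom x z))
                                               (same₀⇒≡ x w e) (id , id)
      ; idom-sound         = λ _ _ ()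
      ; idom-pending       = λ w _ → inj₂ (w , refl , same₀-refl w)
      }
      where
      origin : ∀ {x b m} → (x , b , m) ∈ arcs σ₀ → b ≢ s × b ≡ b × Σ (Fin n) λ a → (a , b) ∈ A × a ≡ x
      origin e∈ with ∈-map⁻ _ e∈
      ... | (a , b) , a→b , refl = (λ { refl → noArcIntoS a a→b }) , refl , a , a→b , refl
      unmarked : ∀ {x b} → (x , b , true) ∈ arcs σ₀ → Anc s p x (p b) × toℕ x ≤ 0
      unmarked e∈ with ∈-map⁻ _ e∈
      ... | _ , _ , ()

    initial-unmarkedArcInto : UnmarkedArcInto (arcs σ₀) id
    initial-unmarkedArcInto b _ b≢s = p b , ∈-map⁺ _ (proj₁ spanning b b≢s)

  module NextStep (noLoops : NoLoops A) (acyclic : Acyclic A)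
      {c as π sm d rep} (I : Invariant c as π sm d rep) (unmarkedInto : UnmarkedArcInto as rep) (c<n : c < n)
      (nothingSelectable : ¬ (Σ (Fin (length as)) λ i → Σ (Fin n) λ u′ → Σ (Fin n) λ v →
                                Selectable s (st c as π sm d) i u′ v)) where
    open Consequences I

    u : Fin n
    u = fromℕ< c<n

    toℕ-u : toℕ u ≡ c
    toℕ-u = toℕ-fromℕ< c<n

    alive-u : Alive rep u
    alive-u = unprocessed-alive u (ℕ.≤-reflexive (sym toℕ-u))

    AliveProperlyDominated : Fin n → Set
    AliveProperlyDominated w = Alive rep w × Dom u w × w ≢ u

    -- An unmarked arc (x, w) into such a w must come from another such vertex x: were x = u,
    -- the arc would be selectable, since u, dominating w, is a tree ancestor of w.
    unmarked-predecessor : ∀ w → AliveProperlyDominated w →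
      Σ (Fin n) λ x → AliveProperlyDominated x × Reach⁺ x w
    unmarked-predecessor w (aw , duw , w≢u) with w ≟ s
    ... | yes refl = ⊥-elim (w≢u (s-only (duw _ here)))
      where
      s-only : u ∈ s ∷ [] → s ≡ u
      s-only (here e) = sym e
    ... | no w≢s with unmarkedInto w aw w≢s
    ...   | x , x→w with arc-origin x→w
    ...     | _ , _ , a , a→w , ra with x ≟ u
    ...       | yes refl = ⊥-elim (nothingSelectable (index x→w , u , w , sym (lookup-index x→w) , toℕ-u , kind))
      where
      u-anc-w : Anc s π u w
      u-anc-w = subst (λ t → Anc s π t w) alive-u (dominator-anc u w aw duw)
      kind : TreeArc s π u w ⊎ ForwardArc s π u w
      kind with anc-step⁻ u-anc-w (w≢u ∘ sym) | u ≟ π w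
      ... | _ , anc | yes u≡πw = inj₁ (w≢s , u≡πw)
      ... | _ , anc | no u≢πw  = inj₂ (w≢s , anc , u≢πw)
    ...       | no x≢u = x , (alive-x , dux , x≢u) , walk-arc⇒reach⁺ x⇝a a→w
      where
      classWalk = class-walk a
      x⇝a : Walk A x a (proj₁ classWalk)
      x⇝a = subst (λ t → Walk A t a (proj₁ classWalk)) ra (proj₁ (proj₂ classWalk))
      alive-x : Alive rep x
      alive-x = trans (cong rep (sym ra)) (trans (rep-idem a) ra)
      dux : Dom u x
      dux vs s⇝x with walk-++ s⇝x x⇝a
      ... | us , s⇝a , split with walk-snoc s⇝a a→w
      ...   | zs , s⇝w , split′ with split′ (duw zs s⇝w)
      ...     | inj₂ u≡w = ⊥-elim (w≢u (sym u≡w))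
      ...     | inj₁ u∈us with split u∈us
      ...       | inj₁ u∈vs = u∈vs
      ...       | inj₂ u∈class = ⊥-elim (x≢u (sym (trans (sym alive-u) (trans (proj₂ (proj₂ classWalk) u∈class) ra))))

    properly-dominated-dead : ∀ w → Dom u w → w ≢ u → ¬ Alive rep w
    properly-dominated-dead w duw w≢u aw =
      no-infinite-descent noLoops acyclic AliveProperlyDominated unmarked-predecessor w (aw , duw , w≢u)

    next-invariant : Invariant (suc c) as π sm d rep
    next-invariant = record
      { cur≤n              = c<n
      ; rep-idem           = rep-idem
      ; rep-s              = rep-s
      ; rep-dom            = λ y c+1≤ → rep-dom y (ℕ.≤-trans (ℕ.n≤1+n c) c+1≤)
      ; dom-rep⇒dom        = dom-rep⇒dom
      ; class-walk         = class-walk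
      ; bottomUp           = bottomUp
      ; alive-par          = alive-par
      ; par-arc            = par-arc
      ; dead<cur           = λ x dead → ℕ.m≤n⇒m≤1+n (dead<cur x dead)
      ; alive-rooted       = alive-rooted
      ; arc-origin         = arc-origin
      ; marked-arc         = λ e∈ → proj₁ (marked-arc e∈) , ℕ.m≤n⇒m≤1+n (proj₂ (marked-arc e∈))
      ; arc-present        = arc-present
      ; processed-dom⇒dead = processed
      ; same-root          = same-root
      ; same-refl          = same-refl
      ; same-pdom          = same-pdom
      ; idom-sound         = idom-sound
      ; idom-pending       = idom-pending
      }
      where
      processed : ∀ z w → toℕ z < suc c → Dom z w → w ≢ z → ¬ Alive rep w
      processed z w z<c+1 dz w≢z with ℕ.m≤n⇒m<n∨m≡n (ℕ.≤-pred z<c+1)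
      ... | inj₁ z<c = processed-dom⇒dead z w z<c dz w≢z
      ... | inj₂ z≡c with toℕ-injective (trans z≡c (sym toℕ-u))
      ...   | refl = properly-dominated-dead w dz w≢z

  module MarkStep {c as π sm d rep} (I : Invariant c as π sm d rep) (unmarkedInto : UnmarkedArcInto as rep)
      (i : Fin (length as)) {u v : Fin n} (sel : Selectable s (st c as π sm d) i u v) where
    open Consequences I

    marked : List (MArc n)
    marked = updateAt as i mark

    uv∈as : (u , v , false) ∈ as
    uv∈as = subst (_∈ as) (proj₁ sel) (∈-lookup i)

    uv∈marked : (u , v , true) ∈ marked
    uv∈marked = subst (λ t → mark t ∈ marked) (proj₁ sel) (updated∈updateAt as i mark)

    u-anc-πv : Anc s π u (π v)
    u-anc-πv with proj₂ (proj₂ sel)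
    ... | inj₁ (_ , u≡πv)   = subst (Anc s π u) u≡πv here
    ... | inj₂ (_ , anc , _) = anc

    ∈-marked⁻ : ∀ {e} → e ∈ marked → e ∈ as ⊎ e ≡ (u , v , true)
    ∈-marked⁻ e∈ with ∈-updateAt⁻ as i mark e∈
    ... | inj₁ e∈as = inj₁ e∈as
    ... | inj₂ e≡   = inj₂ (trans e≡ (cong mark (proj₁ sel)))

    mark-invariant : Invariant c marked π sm d rep
    mark-invariant = record
      { cur≤n              = cur≤n
      ; rep-idem           = rep-idem
      ; rep-s              = rep-s
      ; rep-dom            = rep-dom
      ; dom-rep⇒dom        = dom-rep⇒dom
      ; class-walk         = class-walk
      ; bottomUp           = bottomUp
      ; alive-par          = alive-par
      ; par-arc            = par-arc
      ; dead<cur           = dead<cur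
      ; alive-rooted       = alive-rooted
      ; arc-origin         = origin
      ; marked-arc         = marked-from-anc
      ; arc-present        = present
      ; processed-dom⇒dead = processed-dom⇒dead
      ; same-root          = same-root
      ; same-refl          = same-refl
      ; same-pdom          = same-pdom
      ; idom-sound         = idom-sound
      ; idom-pending       = idom-pending
      }
      where
      origin : ∀ {x b m} → (x , b , m) ∈ marked →
        b ≢ s × Alive rep b × Σ (Fin n) λ a → (a , b) ∈ A × rep a ≡ x
      origin e∈ with ∈-marked⁻ e∈
      ... | inj₁ e∈as = arc-origin e∈as
      ... | inj₂ refl = arc-origin uv∈as
      marked-from-anc : ∀ {x b} → (x , b , true) ∈ marked → Anc s π x (π b) × toℕ x ≤ c
      marked-from-anc e∈ with ∈-marked⁻ e∈
      ... | inj₁ e∈as = marked-arc e∈as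
      ... | inj₂ refl = u-anc-πv , ℕ.≤-reflexive (proj₁ (proj₂ sel))
      present : ∀ {a b} → (a , b) ∈ A → Alive rep b → Σ Bool λ m → (rep a , b , m) ∈ marked
      present a→b ab with arc-present a→b ab
      ... | m , e∈ with ∈-updateAt⁺ as i mark e∈
      ...   | inj₁ e∈′     = m , e∈′
      ...   | inj₂ (_ , e∈′) = true , e∈′

    unmarkedInto-except-v : ∀ b → Alive rep b → b ≢ s → b ≢ v → Σ (Fin n) λ x → (x , b , false) ∈ marked
    unmarkedInto-except-v b ab b≢s b≢v with unmarkedInto b ab b≢s
    ... | x , x→b with ∈-updateAt⁺ as i mark x→b
    ...   | inj₁ x→b′    = x , x→b′
    ...   | inj₂ (e , _) = ⊥-elim (b≢v (cong (proj₁ ∘ proj₂) (trans e (proj₁ sel))))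

    mark-unmarkedArcInto : ¬ AllIntoMarked marked v → UnmarkedArcInto marked rep
    mark-unmarkedArcInto ¬all b ab b≢s with b ≟ v
    ... | yes refl = unmarked-into marked v ¬all
    ... | no b≢v   = unmarkedInto-except-v b ab b≢s b≢v

  module ContractFacts {c as π sm d rep} (I : Invariant c as π sm d rep) (unmarkedInto : UnmarkedArcInto as rep)
      (i : Fin (length as)) {u v : Fin n} (sel : Selectable s (st c as π sm d) i u v)
      (allMarked : AllIntoMarked (updateAt as i mark) v) where
    open MarkStep I unmarkedInto i sel public
    open Consequences mark-invariant public

    private
      uv-origin = arc-origin uv∈marked

    v≢s : v ≢ s
    v≢s = proj₁ uv-origin

    alive-v : Alive rep v
    alive-v = proj₁ (proj₂ uv-origin)

    a₀ : Fin n
    a₀ = proj₁ (proj₂ (proj₂ uv-origin))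

    a₀→v : (a₀ , v) ∈ A
    a₀→v = proj₁ (proj₂ (proj₂ (proj₂ uv-origin)))

    rep-a₀ : rep a₀ ≡ u
    rep-a₀ = proj₂ (proj₂ (proj₂ (proj₂ uv-origin)))

    alive-u : Alive rep u
    alive-u = trans (cong rep (sym rep-a₀)) (trans (rep-idem a₀) rep-a₀)

    toℕ-u : toℕ u ≡ c
    toℕ-u = proj₁ (proj₂ sel)

    open Contraction s π bottomUp v v≢s public

    alive-q : Alive rep q
    alive-q = alive-par v alive-v v≢s

    v<q : toℕ v < toℕ q
    v<q = bottomUp v v≢s

    q≤c : toℕ q ≤ c
    q≤c = subst (toℕ q ≤_) toℕ-u (anc⇒≥ u-anc-πv)

    s≢v : s ≢ v
    s≢v = v≢s ∘ sym

    -- All arcs into v are marked, so the last arc of a path to v comes from a vertex whose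
    -- representative lies on the tree path from u to q = p(v).
    last-entry : ∀ vs → Walk A s v vs →
      Σ (Fin n) λ a → Anc s π u (rep a) × Anc s π (rep a) q ×
      Σ (List (Fin n)) λ us → Walk A s a us × us ⊆ vs
    last-entry vs s⇝v with walk-lastArc s⇝v s≢v
    ... | a , a→v , us , s⇝a , sub with arc-present a→v alive-v
    ...   | m , e∈ with allIntoMarked⇒marked allMarked e∈
    ...     | refl with marked-arc e∈
    ...       | a-anc-q , a≤c = a , u-anc-a , a-anc-q , us , s⇝a , sub
      where
      u-anc-a : Anc s π u (rep a)
      u-anc-a with anc-linear a-anc-q u-anc-πv
      ... | inj₂ anc = anc
      ... | inj₁ anc = subst (Anc s π u)
            (toℕ-injective (ℕ.≤-antisym (anc⇒≥ anc) (subst (toℕ (rep a) ≤_) (sym toℕ-u) a≤c))) here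

    dom-v⇒dom-q : ∀ z → Dom z v → z ≢ v → z ≢ q → Dom z q
    dom-v⇒dom-q z dz z≢v z≢q ws s⇝q with par-arc v alive-v v≢s
    ... | a , a→v , ra with class-walk a
    ...   | js , rep-a⇝a , inClass with walk-++ s⇝q (subst (λ t → Walk A t a js) ra rep-a⇝a)
    ...     | us , s⇝a , split with walk-snoc s⇝a a→v
    ...       | zs , s⇝v , split′ with split′ (dz zs s⇝v)
    ...         | inj₂ z≡v = ⊥-elim (z≢v z≡v)
    ...         | inj₁ z∈us with split z∈us
    ...           | inj₁ z∈ws = z∈ws
    ...           | inj₂ z∈class = ⊥-elim (z≢q (trans (sym alive-z) (trans (inClass z∈class) ra)))
      where alive-z = dominator-alive z v dz (z≢v ∘ sym) alive-v

    -- In the forward case q lies strictly below u, so a path to u through tree-path classes,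
    -- followed by the arc (u, v), avoids q.
    q-not-dom-v : u ≢ q → ¬ Dom q v
    q-not-dom-v u≢q dq with tree-walk (alive-rooted u alive-u) alive-u | class-walk a₀
    ... | ts , s⇝u , between | js , u⇝a₀ , inClass
        with walk-++ s⇝u (subst (λ t → Walk A t a₀ js) rep-a₀ u⇝a₀)
    ...   | us , s⇝a₀ , split with walk-snoc s⇝a₀ a₀→v
    ...     | zs , s⇝v , split′ with split′ (dq zs s⇝v)
    ...       | inj₂ q≡v = q≢v q≡v
    ...       | inj₁ q∈us with split q∈us
    ...         | inj₁ q∈ts = u≢q (anc-antisym u-anc-πv (subst (λ t → Anc s π t u) alive-q (proj₂ (between q∈ts))))
    ...         | inj₂ q∈class = u≢q (sym (trans (sym alive-q) (trans (inClass q∈class) rep-a₀)))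

    module TreeCase (u≡q : u ≡ q) where

      u-dom-v : Dom u v
      u-dom-v vs s⇝v with last-entry vs s⇝v
      ... | a , u-anc-a , a-anc-q , us , s⇝a , sub = sub (subst (_∈ us) rep-a≡u (rep-dom a c≤rep-a us s⇝a))
        where
        rep-a≡u : rep a ≡ u
        rep-a≡u = anc-antisym (subst (Anc s π (rep a)) (sym u≡q) a-anc-q) u-anc-a
        c≤rep-a : c ≤ toℕ (rep a)
        c≤rep-a = subst (c ≤_) (cong toℕ (sym rep-a≡u)) (ℕ.≤-reflexive (sym toℕ-u))

      u-idom-v : IsIdom A s u v
      u-idom-v = u-dom-v , u≢v , dominated-by-u
        where
        u≢v : u ≢ v
        u≢v u≡v = ℕ.<-irrefl (cong toℕ (sym u≡v)) (subst (λ t → toℕ v < toℕ t) (sym u≡q) v<q)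
        dominated-by-u : ∀ z → Dom z v → z ≢ v → Dom z u
        dominated-by-u z dz z≢v with z ≟ u
        ... | yes refl = dominates-refl s z
        ... | no z≢u   = subst (Dom z) (sym u≡q) (dom-v⇒dom-q z dz z≢v (λ z≡q → z≢u (trans z≡q (sym u≡q))))

      dom-q⇒dom-v : ∀ z → Alive rep z → z ≢ v → z ≢ q → Anc s π z q → Dom z q → Dom z v
      dom-q⇒dom-v z _ _ _ _ dzq = dominates-trans s dzq (subst (λ t → Dom t v) u≡q u-dom-v)

      q-dom-v : c ≤ toℕ q → Dom q v
      q-dom-v _ = subst (λ t → Dom t v) u≡q u-dom-v

    module ForwardCase (u≢q : u ≢ q) where

      q<c : toℕ q < c
      q<c = subst (toℕ q <_) toℕ-u (anc⇒> u-anc-πv u≢q)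

      q-dom-v : c ≤ toℕ q → Dom q v
      q-dom-v c≤q = ⊥-elim (ℕ.<⇒≱ q<c c≤q)

      -- A dominator z of q is unprocessed, hence a tree ancestor of u; the entry vertex a of
      -- a path to v has rep a between u and q, and z dominates rep a through the tree path
      -- from rep a to q, hence dominates a.
      dom-q⇒dom-v : ∀ z → Alive rep z → z ≢ v → z ≢ q → Anc s π z q → Dom z q → Dom z v
      dom-q⇒dom-v z alive-z z≢v z≢q z-anc-q dzq vs s⇝v with last-entry vs s⇝v
      ... | a , u-anc-a , a-anc-q , us , s⇝a , sub = sub z∈us
        where
        c≤z : c ≤ toℕ z
        c≤z with toℕ z ℕ.<? c
        ... | yes z<c = ⊥-elim (processed-dom⇒dead z q z<c dzq (z≢q ∘ sym) alive-q)
        ... | no z≮c  = ℕ.≮⇒≥ z≮c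
        z-anc-u : Anc s π z u
        z-anc-u with anc-linear z-anc-q u-anc-πv
        ... | inj₁ anc = anc
        ... | inj₂ anc = subst (Anc s π z)
              (toℕ-injective (ℕ.≤-antisym (anc⇒≥ anc) (subst (_≤ toℕ z) (sym toℕ-u) c≤z))) here
        z∈us : z ∈ us
        z∈us with z ≟ rep a
        ... | yes refl = rep-dom a (subst (c ≤_) (cong toℕ (sym z≡u)) (ℕ.≤-reflexive (sym toℕ-u))) us s⇝a
          where
          z≡u : z ≡ u
          z≡u = anc-antisym z-anc-u u-anc-a
        ... | no z≢rep-a = dom-rep⇒dom a z alive-z z≢rep-a (anc-trans z-anc-u u-anc-a) dz-rep-a us s⇝a
          where
          dz-rep-a : Dom z (rep a)
          dz-rep-a ws s⇝rep-a with tree-walk a-anc-q alive-q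
          ... | ts , rep-a⇝q , between with walk-++ s⇝rep-a rep-a⇝q
          ...   | zs , s⇝q , split with split (dzq zs s⇝q)
          ...     | inj₁ z∈ws = z∈ws
          ...     | inj₂ z∈ts = ⊥-elim (z≢rep-a (sym (anc-antisym
                        (subst (Anc s π (rep a)) alive-z (proj₁ (between z∈ts))) (anc-trans z-anc-u u-anc-a))))

      same-pdom-v-q : SameProperDoms v q
      same-pdom-v-q z = to , from
        where
        to : ProperDom v z → ProperDom q z
        to (dz , z≢v) = dom-v⇒dom-q z dz z≢v z≢q , z≢q
          where
          z≢q : z ≢ q
          z≢q z≡q = q-not-dom-v u≢q (subst (λ t → Dom t v) z≡q dz)
        from : ProperDom q z → ProperDom v z
        from (dzq , z≢q) = dom-q⇒dom-v z alive-z z≢v z≢q z-anc-q dzq , z≢v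
          where
          alive-z = dominator-alive z q dzq (z≢q ∘ sym) alive-q
          z-anc-q : Anc s π z q
          z-anc-q = subst (λ t → Anc s π t q) alive-z (dominator-anc z q alive-q dzq)
          z≢v : z ≢ v
          z≢v z≡v = ℕ.<-irrefl refl (ℕ.<-≤-trans v<q (subst (λ t → toℕ q ≤ toℕ t) z≡v (anc⇒≥ z-anc-q)))

    rep′ : Fin n → Fin n
    rep′ y = f (rep y)

    contracted : List (MArc n)
    contracted = contractArcs v q marked

    alive′⇒alive : ∀ {z} → Alive rep′ z → Alive rep z × z ≢ v
    alive′⇒alive {z} alive′ = [ in-v , not-in-v ]′ (toSum (rep z ≟ v))
      where
      in-v : rep z ≡ v → Alive rep z × z ≢ v
      in-v rz≡v = ⊥-elim (q≢v (trans (sym alive-q) (trans (cong rep (trans (sym (trans (cong f rz≡v) f-v)) alive′)) rz≡v)))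
      not-in-v : rep z ≢ v → Alive rep z × z ≢ v
      not-in-v rz≢v = trans (sym (f-id rz≢v)) alive′ , λ z≡v → rz≢v (trans (cong rep z≡v) alive-v)

    alive⇒alive′ : ∀ {z} → Alive rep z → z ≢ v → Alive rep′ z
    alive⇒alive′ alive z≢v = trans (cong f alive) (f-id z≢v)

    rep′-v : ∀ {y} → rep y ≡ v → rep′ y ≡ q
    rep′-v e = trans (cong f e) f-v

    rep′-other : ∀ {y} → rep y ≢ v → rep′ y ≡ rep y
    rep′-other = f-id

    alive-q′ : Alive rep′ q
    alive-q′ = alive⇒alive′ alive-q q≢v

    rep′-idem : ∀ y → rep′ (rep′ y) ≡ rep′ y
    rep′-idem y = [ in-v , not-in-v ]′ (toSum (rep y ≟ v))
      where
      in-v : rep y ≡ v → rep′ (rep′ y) ≡ rep′ y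
      in-v e = trans (cong rep′ (rep′-v e)) (trans alive-q′ (sym (rep′-v e)))
      not-in-v : rep y ≢ v → rep′ (rep′ y) ≡ rep′ y
      not-in-v ne = trans (cong rep′ (rep′-other ne)) (cong f (rep-idem y))

    rep′-s : rep′ s ≡ s
    rep′-s = trans (cong f rep-s) (f-id s≢v)

    rep′-dom : (c ≤ toℕ q → Dom q v) → ∀ y → c ≤ toℕ (rep′ y) → Dom (rep′ y) y
    rep′-dom q-dom-v y c≤ = [ in-v , not-in-v ]′ (toSum (rep y ≟ v))
      where
      in-v : rep y ≡ v → Dom (rep′ y) y
      in-v e = subst (λ t → Dom t y) (sym (rep′-v e))
        (dom-rep⇒dom y q alive-q (λ q≡ → q≢v (trans q≡ e)) (subst (Anc s π q) (sym e) (up v≢s here))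
          (subst (Dom q) (sym e) (q-dom-v (subst (λ t → c ≤ toℕ t) (rep′-v e) c≤))))
      not-in-v : rep y ≢ v → Dom (rep′ y) y
      not-in-v ne = subst (λ t → Dom t y) (sym (rep′-other ne)) (rep-dom y (subst (λ t → c ≤ toℕ t) (rep′-other ne) c≤))

    dom-rep′⇒dom : (∀ z → Alive rep z → z ≢ v → z ≢ q → Anc s π z q → Dom z q → Dom z v) →
      ∀ y z → Alive rep′ z → z ≢ rep′ y → Anc s π′ z (rep′ y) → Dom z (rep′ y) → Dom z y
    dom-rep′⇒dom dom-q⇒dom-v y z alive′ z≢ anc′ dz = [ in-v , not-in-v ]′ (toSum (rep y ≟ v))
      where
      alive-z = proj₁ (alive′⇒alive alive′)
      z≢v = proj₂ (alive′⇒alive alive′)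
      uncontract = anc-uncontract (Alive rep) alive-par alive-q
      in-v : rep y ≡ v → Dom z y
      in-v e = dom-rep⇒dom y z alive-z (λ z≡ → z≢v (trans z≡ e)) (subst (Anc s π z) (sym e) (up v≢s z-anc-q))
                 (subst (Dom z) (sym e) (dom-q⇒dom-v z alive-z z≢v z≢q z-anc-q (subst (Dom z) (rep′-v e) dz)))
        where
        z≢q : z ≢ q
        z≢q z≡q = z≢ (trans z≡q (sym (rep′-v e)))
        z-anc-q : Anc s π z q
        z-anc-q = uncontract (subst (Anc s π′ z) (rep′-v e) anc′) alive-q q≢v
      not-in-v : rep y ≢ v → Dom z y
      not-in-v ne = dom-rep⇒dom y z alive-z (λ z≡ → z≢ (trans z≡ (sym (rep′-other ne))))
                      (uncontract (subst (Anc s π′ z) (rep′-other ne) anc′) (rep-idem y) ne)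
                      (subst (Dom z) (rep′-other ne) dz)

    -- The class of q absorbs that of v, linked by a path from q through the tree arc into v.
    class-walk′ : ∀ y → Σ (List (Fin n)) λ vs → Walk A (rep′ y) y vs × (∀ {t} → t ∈ vs → rep′ t ≡ rep′ y)
    class-walk′ y = [ in-v , not-in-v ]′ (toSum (rep y ≟ v))
      where
      not-in-v : rep y ≢ v → Σ (List (Fin n)) λ vs → Walk A (rep′ y) y vs × (∀ {t} → t ∈ vs → rep′ t ≡ rep′ y)
      not-in-v ne with class-walk y
      ... | vs , w , inClass = vs , subst (λ t → Walk A t y vs) (sym (rep′-other ne)) w ,
            λ t∈ → trans (rep′-other (λ e → ne (trans (sym (inClass t∈)) e))) (trans (inClass t∈) (sym (rep′-other ne)))
      in-v : rep y ≡ v → Σ (List (Fin n)) λ vs → Walk A (rep′ y) y vs × (∀ {t} → t ∈ vs → rep′ t ≡ rep′ y)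
      in-v e with par-arc v alive-v v≢s
      ... | a , a→v , ra with class-walk a | class-walk y
      ...   | js , q⇝a , inClass-a | ys , v⇝y , inClass-y with walk-snoc (subst (λ t → Walk A t a js) ra q⇝a) a→v
      ...     | zs , q⇝v , split with walk-++ q⇝v (subst (λ t → Walk A t y ys) e v⇝y)
      ...       | us , q⇝y , split′ = us , subst (λ t → Walk A t y us) (sym (rep′-v e)) q⇝y ,
                                      λ t∈ → trans (in-q (split′ t∈)) (sym (rep′-v e))
        where
        in-q : ∀ {t} → t ∈ zs ⊎ t ∈ ys → rep′ t ≡ q
        in-q (inj₂ t∈) = rep′-v (trans (inClass-y t∈) e)
        in-q (inj₁ t∈) with split t∈
        ... | inj₁ t∈js = trans (cong f (trans (inClass-a t∈js) ra)) (f-id q≢v)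
        ... | inj₂ refl = rep′-v alive-v

    bottomUp′ : BottomUp s π′
    bottomUp′ x x≢s = [ child , other ]′ (toSum (π x ≟ v))
      where
      child : π x ≡ v → x <ᶠ π′ x
      child e = subst (λ t → toℕ x < toℕ t) (sym (π′-child e))
                  (ℕ.<-trans (subst (λ t → toℕ x < toℕ t) e (bottomUp x x≢s)) v<q)
      other : π x ≢ v → x <ᶠ π′ x
      other ne = subst (λ t → toℕ x < toℕ t) (sym (π′-other ne)) (bottomUp x x≢s)

    alive-par′ : ∀ x → Alive rep′ x → x ≢ s → Alive rep′ (π′ x)
    alive-par′ x alive′ x≢s = [ child , other ]′ (toSum (π x ≟ v))
      where
      child : π x ≡ v → Alive rep′ (π′ x)
      child e = subst (λ t → rep′ t ≡ t) (sym (π′-child e)) alive-q′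
      other : π x ≢ v → Alive rep′ (π′ x)
      other ne = subst (λ t → rep′ t ≡ t) (sym (π′-other ne))
                   (alive⇒alive′ (alive-par x (proj₁ (alive′⇒alive alive′)) x≢s) ne)

    par-arc′ : ∀ x → Alive rep′ x → x ≢ s → Σ (Fin n) λ a → (a , x) ∈ A × rep′ a ≡ π′ x
    par-arc′ x alive′ x≢s with par-arc x (proj₁ (alive′⇒alive alive′)) x≢s
    ... | a , a→x , ra = a , a→x , cong f ra

    dead′<cur : ∀ x → ¬ Alive rep′ x → toℕ x < c
    dead′<cur x dead′ with rep x ≟ x
    ... | no dead = dead<cur x dead
    ... | yes alive with x ≟ v
    ...   | yes refl = ℕ.<-≤-trans v<q q≤c
    ...   | no x≢v   = ⊥-elim (dead′ (alive⇒alive′ alive x≢v))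

    alive′-rooted : ∀ y → Alive rep′ y → Anc s π′ s y
    alive′-rooted y alive′ with alive′⇒alive alive′
    ... | alive , y≢v = subst₂ (Anc s π′) (f-id s≢v) (f-id y≢v) (anc-contract (alive-rooted y alive))

    arc-origin′ : ∀ {x b m} → (x , b , m) ∈ contracted →
      b ≢ s × Alive rep′ b × Σ (Fin n) λ a → (a , b) ∈ A × rep′ a ≡ x
    arc-origin′ e∈ with ∈-contractArcs⁻ v q e∈
    ... | x , b , m , e∈marked , b≢v , refl with arc-origin e∈marked
    ...   | b≢s , alive-b , a , a→b , ra =
            subst (_≢ s) (sym (f-id b≢v)) b≢s ,
            trans (cong rep′ (f-id b≢v)) (trans (alive⇒alive′ alive-b b≢v) (sym (f-id b≢v))) ,
            a , subst (λ t → (a , t) ∈ A) (sym (f-id b≢v)) a→b , cong f ra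

    marked-arc′ : ∀ {x b} → (x , b , true) ∈ contracted → Anc s π′ x (π′ b) × toℕ x ≤ c
    marked-arc′ e∈ with ∈-contractArcs⁻ v q e∈
    ... | x , b , m , e∈marked , b≢v , refl with marked-arc e∈marked
    ...   | anc , x≤c = subst (λ t → Anc s π′ (f x) (π′ t)) (sym (f-id b≢v)) (anc-contract anc) , fx≤c
      where
      fx≤c : toℕ (f x) ≤ c
      fx≤c = [ (λ e → subst (λ t → toℕ t ≤ c) (sym (trans (cong f e) f-v)) q≤c)
             , (λ ne → subst (λ t → toℕ t ≤ c) (sym (f-id ne)) x≤c) ]′ (toSum (x ≟ v))

    arc-present′ : ∀ {a b} → (a , b) ∈ A → Alive rep′ b → Σ Bool λ m → (rep′ a , b , m) ∈ contracted
    arc-present′ {a} a→b alive′ with alive′⇒alive alive′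
    ... | alive , b≢v with arc-present a→b alive
    ...   | m , e∈ = m , subst (λ t → (rep′ a , t , m) ∈ contracted) (f-id b≢v) (∈-contractArcs⁺ v q e∈ b≢v)

    processed-dom⇒dead′ : ∀ z w → toℕ z < c → Dom z w → w ≢ z → ¬ Alive rep′ w
    processed-dom⇒dead′ z w z<c dz w≢z alive′ = processed-dom⇒dead z w z<c dz w≢z (proj₁ (alive′⇒alive alive′))

    contract-unmarkedArcInto : UnmarkedArcInto contracted rep′
    contract-unmarkedArcInto b alive′ b≢s with alive′⇒alive alive′
    ... | alive , b≢v with unmarkedInto-except-v b alive b≢s b≢v
    ...   | x , x→b = f x , subst (λ t → (f x , t , false) ∈ contracted) (f-id b≢v) (∈-contractArcs⁺ v q x→b b≢v)

    contract-invariant : (c ≤ toℕ q → Dom q v) →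
      (∀ z → Alive rep z → z ≢ v → z ≢ q → Anc s π z q → Dom z q → Dom z v) →
      ∀ {sm′ d′} →
      (∀ x w → sm′ x w ≡ true → x ≡ w ⊎ x ≢ s) →
      (∀ x → sm′ x x ≡ true) →
      (∀ x w → sm′ x w ≡ true → SameProperDoms x w) →
      (∀ w x → d′ w ≡ just x → IsIdom A s x w) →
      (∀ w → w ≢ s → (Σ (Fin n) λ x → d′ w ≡ just x) ⊎ (Σ (Fin n) λ x → Alive rep′ x × sm′ x w ≡ true)) →
      Invariant c contracted π′ sm′ d′ rep′
    contract-invariant q-dom-v dom-q⇒dom-v same-root′ same-refl′ same-pdom′ idom-sound′ idom-pending′ = record
      { cur≤n              = cur≤n
      ; rep-idem           = rep′-idem
      ; rep-s              = rep′-s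
      ; rep-dom            = rep′-dom q-dom-v
      ; dom-rep⇒dom        = dom-rep′⇒dom dom-q⇒dom-v
      ; class-walk         = class-walk′
      ; bottomUp           = bottomUp′
      ; alive-par          = alive-par′
      ; par-arc            = par-arc′
      ; dead<cur           = dead′<cur
      ; alive-rooted       = alive′-rooted
      ; arc-origin         = arc-origin′
      ; marked-arc         = marked-arc′
      ; arc-present        = arc-present′
      ; processed-dom⇒dead = processed-dom⇒dead′
      ; same-root          = same-root′
      ; same-refl          = same-refl′
      ; same-pdom          = same-pdom′
      ; idom-sound         = idom-sound′
      ; idom-pending       = idom-pending′
      }

  idom-transfer : ∀ {v w x} → SameProperDoms v w → IsIdom A s x v → IsIdom A s x w
  idom-transfer {v} {w} {x} same (x-dom-v , x≢v , dominated) =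
    proj₁ (proj₁ (same x) (x-dom-v , x≢v)) , proj₂ (proj₁ (same x) (x-dom-v , x≢v)) ,
    λ z dz z≢w → let dz′ , z≢v = proj₂ (same z) (dz , z≢w) in dominated z dz′ z≢v

  module TreeStep {c as π sm d rep} (I : Invariant c as π sm d rep) (unmarkedInto : UnmarkedArcInto as rep)
      (i : Fin (length as)) {u v : Fin n} (sel : Selectable s (st c as π sm d) i u v)
      (allMarked : AllIntoMarked (updateAt as i mark) v) (u≡πv : u ≡ π v) where
    open ContractFacts I unmarkedInto i sel allMarked
    open TreeCase u≡πv

    d′ : Fin n → Maybe (Fin n)
    d′ w = if sm v w then just u else d w

    idom-sound′ : ∀ w x → d′ w ≡ just x → IsIdom A s x w
    idom-sound′ w x d′w≡ with sm v w in sm-v-w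
    ... | true  = subst (λ t → IsIdom A s t w) (just-injective d′w≡) (idom-transfer (same-pdom v w sm-v-w) u-idom-v)
    ... | false = idom-sound w x d′w≡

    idom-pending′ : ∀ w → w ≢ s →
      (Σ (Fin n) λ x → d′ w ≡ just x) ⊎ (Σ (Fin n) λ x → Alive rep′ x × sm x w ≡ true)
    idom-pending′ w w≢s with idom-pending w w≢s
    ... | inj₁ (x , dw≡) = inj₁ (assigned (sm v w))
      where
      assigned : ∀ b → Σ (Fin n) λ x → (if b then just u else d w) ≡ just x
      assigned true  = u , refl
      assigned false = x , dw≡
    ... | inj₂ (x , alive-x , sm-x-w) with x ≟ v
    ...   | yes refl = inj₁ (u , subst (λ b → (if b then just u else d w) ≡ just u) (sym sm-x-w) refl)
    ...   | no x≢v   = inj₂ (x , alive⇒alive′ alive-x x≢v , sm-x-w)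

    tree-invariant : Invariant c contracted π′ sm d′ rep′
    tree-invariant = contract-invariant q-dom-v dom-q⇒dom-v same-root same-refl same-pdom idom-sound′ idom-pending′

  module ForwardStep {c as π sm d rep} (I : Invariant c as π sm d rep) (unmarkedInto : UnmarkedArcInto as rep)
      (i : Fin (length as)) {u v : Fin n} (sel : Selectable s (st c as π sm d) i u v)
      (allMarked : AllIntoMarked (updateAt as i mark) v) (u≢πv : u ≢ π v) where
    open ContractFacts I unmarkedInto i sel allMarked
    open ForwardCase u≢πv

    sm′ : Fin n → Fin n → Bool
    sm′ x w = if ⌊ x ≟ π v ⌋ then (sm x w ∨ sm v w) else sm x w

    sm′-q : ∀ x w → x ≡ q → sm′ x w ≡ (sm x w ∨ sm v w)
    sm′-q x w x≡q with x ≟ π v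
    ... | yes _  = refl
    ... | no x≢q = ⊥-elim (x≢q x≡q)

    sm′-other : ∀ x w → x ≢ q → sm′ x w ≡ sm x w
    sm′-other x w x≢q with x ≟ π v
    ... | yes x≡q = ⊥-elim (x≢q x≡q)
    ... | no _    = refl

    q≢s : q ≢ s
    q≢s q≡s = u≢πv (trans (anc-root (subst (Anc s π u) q≡s u-anc-πv)) (sym q≡s))

    same-root′ : ∀ x w → sm′ x w ≡ true → x ≡ w ⊎ x ≢ s
    same-root′ x w sm′≡ = [ (λ x≡q → inj₂ (subst (_≢ s) (sym x≡q) q≢s))
                          , (λ x≢q → same-root x w (trans (sym (sm′-other x w x≢q)) sm′≡)) ]′ (toSum (x ≟ q))

    same-refl′ : ∀ x → sm′ x x ≡ true
    same-refl′ x = [ (λ x≡q → trans (sm′-q x x x≡q) (cong (_∨ sm v x) (same-refl x)))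
                   , (λ x≢q → trans (sm′-other x x x≢q) (same-refl x)) ]′ (toSum (x ≟ q))

    same-pdom′ : ∀ x w → sm′ x w ≡ true → SameProperDoms x w
    same-pdom′ x w sm′≡ z = [ merged , (λ x≢q → same-pdom x w (trans (sym (sm′-other x w x≢q)) sm′≡) z) ]′ (toSum (x ≟ q))
      where
      merged : x ≡ q → (ProperDom x z → ProperDom w z) × (ProperDom w z → ProperDom x z)
      merged refl with ∨-true⁻ (sm q w) (sm v w) (trans (sym (sm′-q q w refl)) sm′≡)
      ... | inj₁ sm-q-w = same-pdom q w sm-q-w z
      ... | inj₂ sm-v-w = (λ pq → proj₁ (same-pdom v w sm-v-w z) (proj₂ (same-pdom-v-q z) pq)) ,
                          (λ pw → proj₁ (same-pdom-v-q z) (proj₂ (same-pdom v w sm-v-w z) pw))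

    idom-pending′ : ∀ w → w ≢ s →
      (Σ (Fin n) λ x → d w ≡ just x) ⊎ (Σ (Fin n) λ x → Alive rep′ x × sm′ x w ≡ true)
    idom-pending′ w w≢s with idom-pending w w≢s
    ... | inj₁ assigned = inj₁ assigned
    ... | inj₂ (x , alive-x , sm-x-w) with x ≟ v
    ...   | yes refl = inj₂ (q , alive-q′ , trans (sm′-q q w refl)
                                                 (subst (λ b → sm q w ∨ b ≡ true) (sym sm-x-w) (∨-zeroʳ (sm q w))))
    ...   | no x≢v = inj₂ (x , alive⇒alive′ alive-x x≢v ,
                           [ (λ x≡q → trans (sm′-q x w x≡q) (cong (_∨ sm v w) sm-x-w))
                           , (λ x≢q → trans (sm′-other x w x≢q) sm-x-w) ]′ (toSum (x ≟ q)))

    forward-invariant : Invariant c contracted π′ sm′ d rep′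
    forward-invariant = contract-invariant q-dom-v dom-q⇒dom-v same-root′ same-refl′ same-pdom′ idom-sound idom-pending′

  HasInvariant : State n → Set
  HasInvariant σ = Σ (Fin n → Fin n) λ rep →
    Invariant (cur σ) (arcs σ) (par σ) (same σ) (dom σ) rep × UnmarkedArcInto (arcs σ) rep

  module _ (noLoops : NoLoops A) (acyclic : Acyclic A) where

    step-preserves-HasInvariant : ∀ {σ σ′} → HasInvariant σ → Step s σ σ′ → HasInvariant σ′
    step-preserves-HasInvariant (rep , I , into) (markOnly i sel ¬all) =
      rep , MarkStep.mark-invariant I into i sel , MarkStep.mark-unmarkedArcInto I into i sel ¬all
    step-preserves-HasInvariant (rep , I , into) (markTree i sel all u≡πv) =
      _ , TreeStep.tree-invariant I into i sel all u≡πv , ContractFacts.contract-unmarkedArcInto I into i sel all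
    step-preserves-HasInvariant (rep , I , into) (markFwd i sel all u≢πv) =
      _ , ForwardStep.forward-invariant I into i sel all u≢πv , ContractFacts.contract-unmarkedArcInto I into i sel all
    step-preserves-HasInvariant (rep , I , into) (next c<n ¬sel) =
      rep , NextStep.next-invariant noLoops acyclic I into c<n ¬sel , into

    reachable-HasInvariant : ∀ {σ σ′} → HasInvariant σ → Star (Step s) σ σ′ → HasInvariant σ′
    reachable-HasInvariant inv ε        = inv
    reachable-HasInvariant inv (x ◅ xs) = reachable-HasInvariant (step-preserves-HasInvariant inv x) xs

  selectable? : ∀ σ → BottomUp s (par σ) → ∀ i → Dec (Σ (Fin n) λ u → Σ (Fin n) λ v → Selectable s σ i u v)
  selectable? σ bu i with lookup (arcs σ) i
  ... | x , y , true = no λ { (_ , _ , () , _) }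
  ... | x , y , false with toℕ x ℕ.≟ cur σ
  ...   | no x≢u = no λ { (_ , _ , refl , x≡u , _) → x≢u x≡u }
  ...   | yes x≡u with y ≟ s
  ...     | yes refl = no λ { (_ , _ , refl , _ , inj₁ (y≢s , _)) → y≢s refl
                            ; (_ , _ , refl , _ , inj₂ (y≢s , _)) → y≢s refl }
  ...     | no y≢s with x ≟ par σ y
  ...       | yes tree = yes (x , y , refl , x≡u , inj₁ (y≢s , tree))
  ...       | no ¬tree with BottomUpTree.anc? s (par σ) bu x (par σ y)
  ...         | yes anc = yes (x , y , refl , x≡u , inj₂ (y≢s , anc , ¬tree))
  ...         | no ¬anc = no λ { (_ , _ , refl , _ , inj₁ (_ , tree)) → ¬tree tree
                               ; (_ , _ , refl , _ , inj₂ (_ , anc , _)) → ¬anc anc }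

  module _ {σ : State n} {rep : Fin n → Fin n}
           (I : Invariant (cur σ) (arcs σ) (par σ) (same σ) (dom σ) rep) where
    open Consequences I

    -- Once u has passed every vertex, the processed vertex s properly dominates, hence has
    -- contracted, every other vertex, so no vertex is left pending.
    finished-correct : Finished σ → CorrectIdoms A s σ
    finished-correct done w w≢s with idom-pending w w≢s
    ... | inj₁ (x , dw≡) = x , dw≡ , idom-sound w x dw≡
    ... | inj₂ (x , alive-x , sm-x-w) with x ≟ s
    ...   | yes refl = ⊥-elim ([ (λ s≡w → w≢s (sym s≡w)) , (λ s≢s → s≢s refl) ]′ (same-root s w sm-x-w))
    ...   | no x≢s   = ⊥-elim (processed-dom⇒dead s x (subst (toℕ s <_) (sym done) (toℕ<n s))
                                  (λ _ → walk-head∈) x≢s alive-x)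

    progress : (Σ (State n) λ σ′ → Step s σ σ′) ⊎ (Finished σ × CorrectIdoms A s σ)
    progress with ℕ.m≤n⇒m<n∨m≡n cur≤n
    ... | inj₂ done = inj₂ (done , finished-correct done)
    ... | inj₁ c<n with any? (selectable? σ bottomUp)
    ...   | no ¬sel = inj₁ (_ , next c<n ¬sel)
    ...   | yes (i , u , v , sel) with allIntoMarked? (updateAt (arcs σ) i mark) v
    ...     | no ¬all = inj₁ (_ , markOnly i sel ¬all)
    ...     | yes all with u ≟ par σ v
    ...       | yes u≡πv = inj₁ (_ , markTree i sel all u≡πv)
    ...       | no u≢πv  = inj₁ (_ , markFwd i sel all u≢πv)

theorem2 : (n : ℕ) (A : Arcs n) (s : Fin n) → IsFlowGraph A s → Acyclic A →
    (p : Fin n → Fin n) → IsSpanningTree A s p → BottomUp s p →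
    Acc (λ σ' σ → Step s σ σ') (initState A p) ×
    (∀ σ → Star (Step s) (initState A p) σ →
    (Σ (State n) λ σ' → Step s σ σ') ⊎ (Finished σ × CorrectIdoms A s σ))
theorem2 n A s (_ , _ , noLoops , noArcIntoS , _) acyclic p spanning bottomUp =
  step-wellFounded s (initState A p) ,
  λ σ σ₀⇝σ → let _ , I , _ = reachable-HasInvariant noLoops acyclic initial σ₀⇝σ in progress I
  where
  open AD A s
  open Initial noArcIntoS p spanning bottomUp
  initial : HasInvariant (initState A p)
  initial = id , initial-invariant , initial-unmarkedArcInto
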